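{- Let $q\ge1$ and let $\psi:\mathbb{Z}_q\to\{ -1,+1\}$ be primitive and satisfy the functional equation $$\psi(x)\psi(y)\psi(z)=\psi\!\left(\frac{4xyz-x-y-z}{4(xy+yz+zx)-1}\right)\quad\text{for all }x,y,z\in\mathbb{Z}_q\text{ with }\gcd(4(xy+yz+zx)-1,q)=1.$$ Then $q/2^{v_2(q)}$ is squarefree.
   Context: $\mathbb{Z}_q=\mathbb{Z}/q\mathbb{Z}$; the quotient means multiplication by the inverse in $\mathbb{Z}_q$. $\psi$ (viewed as a $q$-periodic function on $\mathbb{Z}$) is primitive if its smallest period is $q$. $v_2(q)$ is the exponent of $2$ in $q$. -}

module Defs where

open import Data.Nat as ℕ using (ℕ; zero; suc; _^_; _<_; NonZero)
open import Data.Nat.Properties using (m^n≢0)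
open import Data.Nat.Divisibility as ℕD using ()
open import Data.Nat.DivMod using (_/_; _%_)
open import Data.Bool using (if_then_else_)
open import Data.Integer as ℤ using (ℤ; +_; _-_)
open import Data.Integer.Divisibility as ℤD using ()
open import Data.Integer.GCD using (gcd)
open import Data.Sign as Sign using (Sign)
open import Relation.Binary.PropositionalEquality using (_≡_)
open import Relation.Nullary using (¬_; does)
open import Data.Product using (_×_)

-- ψ : ℤ_q → {-1,+1} is represented as a function ℤ → Sign that is q-periodic.
Periodic : (ℤ → Sign) → ℕ → Set
Periodic ψ d = ∀ x → ψ (x ℤ.+ + d) ≡ ψ x

Primitive : ℕ → (ℤ → Sign) → Set
Primitive q ψ = Periodic ψ q × (∀ d → 0 < d → d < q → ¬ Periodic ψ d)

-- the functional equation; the quotient N/D in ℤ_q (D invertible mod q)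
-- is any w with D * w ≡ N (mod q)
FunEq : ℕ → (ℤ → Sign) → Set
FunEq q ψ = ∀ x y z →
  gcd (ℤ.+ 4 ℤ.* (x ℤ.* y ℤ.+ y ℤ.* z ℤ.+ z ℤ.* x) - ℤ.+ 1) (+ q) ≡ + 1 →
  ∀ w → (+ q) ℤD.∣ ((ℤ.+ 4 ℤ.* (x ℤ.* y ℤ.+ y ℤ.* z ℤ.+ z ℤ.* x) - ℤ.+ 1) ℤ.* w
                     - (ℤ.+ 4 ℤ.* x ℤ.* y ℤ.* z - x - y - z)) →
  (ψ x Sign.* ψ y Sign.* ψ z) ≡ ψ w

-- 2-adic valuation (with v2 0 = 0 by convention; only used for q ≥ 1)
v2-fuel : ℕ → ℕ → ℕ
v2-fuel zero n = 0
v2-fuel (suc f) zero = 0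
v2-fuel (suc f) (suc m) =
  if does ((suc m % 2) ℕ.≟ 0) then suc (v2-fuel f (suc m / 2)) else 0

v2 : ℕ → ℕ
v2 n = v2-fuel n n

oddPart : ℕ → ℕ
oddPart q = _/_ q (2 ^ v2 q) {{m^n≢0 2 (v2 q)}}

Squarefree : ℕ → Set
Squarefree n = ∀ d → d ℕ.* d ℕD.∣ n → d ≡ 1

-- Suppose p² ∣ q for an odd prime p and put m = q/p, so that m² ≡ 0 (mod q); we show that ψ is
-- m-periodic, contradicting primitivity. With (x, y) = (0, mc) the functional equation reads
-- ψ(0) ψ(mc) ψ(z) = ψ(z + mc(1 + 4z²)). Taking z = mn gives ψ(m(n+1)) = ψ(0) ψ(m) ψ(mn), and as
-- ψ(mp) = ψ(0) with p odd, ψ ≡ ψ(0) on mℤ; hence ψ(z + mc(1 + 4z²)) = ψ(z) for all c. If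
-- p ∤ 1 + 4z², choose c ≡ (1 + 4z²)⁻¹ (mod p) to get ψ(z + m) = ψ(z). Otherwise use y = 0, where the
-- equation reads ψ(x) ψ(0) ψ(z′) = ψ((x + z′)/(1 − 4xz′)): for z′ ≡ z modulo p and z′ ≡ 0 modulo
-- the other primes of q, 1 − 4zz′ is a unit, and the quotients for x = z and x = z + m agree since
-- their cross-multiplied difference is m(1 + 4z′²) ≡ 0 (mod q).

module Submission where

open import Defs
open import Data.Nat using (ℕ; _≤_)
open import Data.Integer using (ℤ)
open import Data.Sign using (Sign)
open import Data.Nat.Primality using (Prime)
open import Relation.Nullary using (¬_; yes; no)
open import Data.Product using (_,_)
open import Data.Empty using (⊥-elim)
open import Relation.Binary.PropositionalEquality using (_≡_)
import Data.Nat as ℕ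
import Data.Nat.Divisibility as ℕ

module Primes where
  open import Data.Nat
  open import Data.Nat.Properties
  open import Data.Nat.Divisibility
  open import Data.Nat.Primality
  open import Data.Nat.Primality.Factorisation using (factorise)
  open import Data.Nat.GCD using (gcd; gcd[m,n]∣m; gcd[m,n]∣n)
  open import Data.Nat.Induction using (<-rec)
  open import Data.Nat.Tactic.RingSolver using (solve-∀)
  open import Data.List using ([]; _∷_)
  open import Data.List.Relation.Unary.All using (_∷_)
  open import Data.Product using (∃-syntax; ∃₂; _×_)
  open import Data.Sum using (inj₁; inj₂)
  open import Data.Empty using (⊥)
  open import Relation.Binary.PropositionalEquality

  prime>1 : ∀ {p} → Prime p → 1 < p
  prime>1 {p} p-prime = nonTrivial⇒n>1 p {{prime⇒nonTrivial p-prime}}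

  prime-divisor : ∀ n .{{_ : NonZero n}} → 1 < n → ∃[ p ] Prime p × p ∣ n
  prime-divisor n 1<n with factorise n
  ... | record { factors = [] ; isFactorisation = n≡1 } = ⊥-elim (<⇒≢ 1<n (sym n≡1))
  ... | record { factors = p ∷ ps ; isFactorisation = n≡p*ps ; factorsPrime = p-prime ∷ _ } =
    p , p-prime , subst (p ∣_) (sym n≡p*ps) (m∣m*n _)

  prime∣prime⇒≡ : ∀ {r p} → Prime r → Prime p → r ∣ p → r ≡ p
  prime∣prime⇒≡ r-prime p-prime r∣p with prime⇒irreducible p-prime r∣p
  ... | inj₁ r≡1 = ⊥-elim (<⇒≢ (prime>1 r-prime) (sym r≡1))
  ... | inj₂ r≡p = r≡p

  prime∣^⇒≡ : ∀ {r p} a → Prime r → Prime p → r ∣ p ^ a → r ≡ p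
  prime∣^⇒≡ zero r-prime _ r∣1 = ⊥-elim (<⇒≢ (prime>1 r-prime) (sym (∣1⇒≡1 r∣1)))
  prime∣^⇒≡ {p = p} (suc a) r-prime p-prime r∣p^[1+a]
    with euclidsLemma p (p ^ a) r-prime r∣p^[1+a]
  ... | inj₁ r∣p   = prime∣prime⇒≡ r-prime p-prime r∣p
  ... | inj₂ r∣p^a = prime∣^⇒≡ a r-prime p-prime r∣p^a

  no-common-prime⇒gcd≡1 : ∀ m n → (∀ r → Prime r → r ∣ m → r ∣ n → ⊥) → gcd m n ≡ 1
  no-common-prime⇒gcd≡1 m n no-common with gcd m n | gcd[m,n]∣m m n | gcd[m,n]∣n m n
  ... | 0 | 0∣m | 0∣n = ⊥-elim (no-common 2 prime[2]
                          (subst (2 ∣_) (sym (0∣⇒≡0 0∣m)) (2 ∣0))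
                          (subst (2 ∣_) (sym (0∣⇒≡0 0∣n)) (2 ∣0)))
  ... | 1 | _ | _ = refl
  ... | g@(suc (suc _)) | g∣m | g∣n with r , r-prime , r∣g ← prime-divisor g (s≤s (s≤s z≤n)) =
    ⊥-elim (no-common r r-prime (∣-trans r∣g g∣m) (∣-trans r∣g g∣n))

  ¬prime∣⇒gcd≡1 : ∀ {p n} → Prime p → ¬ p ∣ n → gcd n p ≡ 1
  ¬prime∣⇒gcd≡1 {p} {n} p-prime p∤n = no-common-prime⇒gcd≡1 n p λ r r-prime r∣n r∣p →
    p∤n (subst (_∣ n) (prime∣prime⇒≡ r-prime p-prime r∣p) r∣n)

  square-divisor-cofactor : ∀ {p q} .{{_ : NonZero q}} → 1 < p → p * p ∣ q →
                            ∃[ m ] 0 < m × m < q × q ≡ m * p × p ∣ m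
  square-divisor-cofactor {p} {q} 1<p (divides s q≡s*[p*p]) =
    s * p , >-nonZero⁻¹ _ {{quotient≢0 p∣q}} , quotient-< p∣q {{n>1⇒nonTrivial 1<p}} ,
    q≡s*p*p , n∣m*n s
    where
    q≡s*p*p : q ≡ s * p * p
    q≡s*p*p = trans q≡s*[p*p] (sym (*-assoc s p p))
    p∣q : p ∣ q
    p∣q = divides (s * p) q≡s*p*p

  prime-power-split : ∀ {p} → 1 < p → ∀ q .{{_ : NonZero q}} →
                      ∃₂ λ a n → q ≡ p ^ a * n × ¬ p ∣ n
  prime-power-split {p} 1<p = <-rec _ split
    where
    instance _ = n>1⇒nonTrivial 1<p
    split : ∀ q → (∀ {k} → k < q → .{{_ : NonZero k}} → ∃₂ λ a n → k ≡ p ^ a * n × ¬ p ∣ n) →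
            .{{_ : NonZero q}} → ∃₂ λ a n → q ≡ p ^ a * n × ¬ p ∣ n
    split q split< with p ∣? q
    ... | no ¬p∣q = 0 , q , sym (+-identityʳ q) , ¬p∣q
    ... | yes p∣q@(divides k q≡k*p)
      with a , n , k≡p^a*n , ¬p∣n ← split< (quotient-< p∣q) {{quotient≢0 p∣q}} =
      suc a , n , trans q≡k*p (trans (cong (_* p) k≡p^a*n) (reassoc (p ^ a) n p)) , ¬p∣n
      where
      reassoc : ∀ x n p → x * n * p ≡ p * x * n
      reassoc = solve-∀

module Parity where
  open import Data.Nat
  open import Data.Nat.Divisibility
  open import Data.Sign using (Sign; +; -; opposite) renaming (_*_ to _·_)
  open import Data.Sign.Properties using (s≢opposite[s]; opposite-involutive)
  open import Data.Product using (∃-syntax; map)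
  open import Function using (_∘_)
  open import Relation.Binary.PropositionalEquality

  odd⇒≡1+k*2 : ∀ {n} → ¬ 2 ∣ n → ∃[ k ] n ≡ suc (k * 2)
  odd⇒≡1+k*2 {zero} ¬2∣0 = ⊥-elim (¬2∣0 (2 ∣0))
  odd⇒≡1+k*2 {suc zero} _ = 0 , refl
  odd⇒≡1+k*2 {suc (suc n)} ¬2∣2+n =
    map suc (cong (suc ∘ suc)) (odd⇒≡1+k*2 (¬2∣2+n ∘ ∣m∣n⇒∣m+n (∣-refl {2})))

  odd-return⇒constant : ∀ (f : ℕ → Sign) t → (∀ n → f (suc n) ≡ t · f n) →
                        ∀ {p} → ¬ 2 ∣ p → f p ≡ f 0 → ∀ n → f n ≡ f 0
  odd-return⇒constant f + step _ _ = constant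
    where
    constant : ∀ n → f n ≡ f 0
    constant zero    = refl
    constant (suc n) = trans (step n) (constant n)
  odd-return⇒constant f - step ¬2∣p fp≡f0 with k , refl ← odd⇒≡1+k*2 ¬2∣p =
    ⊥-elim (s≢opposite[s] (f 0) (trans (sym fp≡f0) (odd k)))
    where
    even : ∀ k → f (k * 2) ≡ f 0
    odd  : ∀ k → f (suc (k * 2)) ≡ opposite (f 0)
    even zero    = refl
    even (suc k) = trans (step _) (trans (cong opposite (odd k)) (opposite-involutive (f 0)))
    odd k        = trans (step _) (cong opposite (even k))

module TwoAdic where
  open import Data.Nat
  open import Data.Nat.Properties
  open import Data.Nat.Divisibility
  open import Data.Nat.DivMod
  open import Data.Product using (∃-syntax; _×_; proj₁; proj₂)
  open import Data.Bool using (true; false; T)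
  open import Function using (_∘_; flip)
  open import Relation.Binary.PropositionalEquality
  open Primes using (prime-divisor)

  v2-fuel-split : ∀ f n .{{_ : NonZero n}} → n ≤ f →
                  ∃[ r ] n ≡ r * 2 ^ v2-fuel f n × ¬ 2 ∣ r
  v2-fuel-split (suc f) n@(suc _) n≤f with n % 2 ≡ᵇ 0 in n%2≡ᵇ0
  ... | false = n , sym (*-identityʳ n) ,
        λ 2∣n → subst T n%2≡ᵇ0 (≡⇒≡ᵇ _ 0 (n∣m⇒m%n≡0 n 2 2∣n))
  ... | true with n / 2 | trans (m≡m%n+[m/n]*n n 2)
                                (cong (_+ n / 2 * 2) (≡ᵇ⇒≡ _ 0 (subst T (sym n%2≡ᵇ0) _)))
  ...   | suc h | n≡h*2
    with r , h≡r*2^v , ¬2∣r ← v2-fuel-split f (suc h)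
           (≤-pred (≤-trans (subst (suc h <_) (sym n≡h*2) (m<m*n (suc h) 2 ≤-refl)) n≤f))
    = r , (begin
      n                            ≡⟨ n≡h*2 ⟩
      suc h * 2                    ≡⟨ cong (_* 2) h≡r*2^v ⟩
      r * 2 ^ v2-fuel f (suc h) * 2 ≡⟨ *-assoc r _ 2 ⟩
      r * (2 ^ v2-fuel f (suc h) * 2) ≡⟨ cong (r *_) (*-comm (2 ^ v2-fuel f (suc h)) 2) ⟩
      r * 2 ^ suc (v2-fuel f (suc h)) ∎) , ¬2∣r
    where open ≡-Reasoning

  oddPart-spec : ∀ q .{{_ : NonZero q}} → q ≡ oddPart q * 2 ^ v2 q × ¬ 2 ∣ oddPart q
  oddPart-spec q with r , q≡r*2^v , ¬2∣r ← v2-fuel-split q q ≤-refl =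
    subst (λ o → q ≡ o * 2 ^ v2 q × ¬ 2 ∣ o) (sym oddPart≡r) (q≡r*2^v , ¬2∣r)
    where
    instance _ = m^n≢0 2 (v2 q)
    oddPart≡r : oddPart q ≡ r
    oddPart≡r = trans (cong (_/ 2 ^ v2 q) q≡r*2^v) (m*n/n≡m r (2 ^ v2 q))

  odd-prime-square-divisor : ∀ {q d} .{{_ : NonZero q}} → d * d ∣ oddPart q → d ≢ 1 →
                             ∃[ p ] Prime p × ¬ 2 ∣ p × p * p ∣ q
  odd-prime-square-divisor {q} {zero} 0∣oddPart _ =
    ⊥-elim (≢-nonZero⁻¹ q (trans (proj₁ (oddPart-spec q)) (cong (_* 2 ^ v2 q) (0∣⇒≡0 0∣oddPart))))
  odd-prime-square-divisor {d = 1} _ d≢1 = ⊥-elim (d≢1 refl)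
  odd-prime-square-divisor {q} {d@(suc (suc _))} d²∣oddPart _
    with p , p-prime , p∣d ← prime-divisor d (s≤s (s≤s z≤n)) =
    p , p-prime , ¬2∣oddPart ∘ flip ∣-trans (∣-trans (m∣m*n p) p²∣oddPart) ,
    ∣-trans p²∣oddPart oddPart∣q
    where
    q≡oddPart*2^v2 = proj₁ (oddPart-spec q)
    ¬2∣oddPart = proj₂ (oddPart-spec q)
    p²∣oddPart : p * p ∣ oddPart q
    p²∣oddPart = ∣-trans (*-pres-∣ p∣d p∣d) d²∣oddPart
    oddPart∣q : oddPart q ∣ q
    oddPart∣q = divides (2 ^ v2 q) (trans q≡oddPart*2^v2 (*-comm (oddPart q) _))

module Residues where
  import Data.Nat as ℕ
  open import Data.Nat.Coprimality using (coprime-Bézout; gcd≡1⇒coprime)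
  open import Data.Nat.GCD using (gcd; module Bézout)
  open import Data.Integer
  open import Data.Integer.Properties using (pos-*; *-comm; neg-distribˡ-*; +-identityʳ)
  open import Data.Integer.Divisibility.Signed
  open import Data.Integer.Tactic.RingSolver using (solve-∀)
  open import Data.Product using (∃-syntax)
  open import Relation.Binary.PropositionalEquality

  bézout⇒inverse : ∀ {a n} → Bézout.Identity 1 a n → ∃[ b ] + n ∣ + a * b - 1ℤ
  bézout⇒inverse {a} {n} (Bézout.+- x y 1+y*n≡x*a) = + x , divides (+ y) (begin
    + a * + x - 1ℤ           ≡⟨ cong (_- 1ℤ) (trans (*-comm (+ a) (+ x)) (sym (pos-* x a))) ⟩
    + (x ℕ.* a) - 1ℤ         ≡⟨ cong (λ t → + t - 1ℤ) 1+y*n≡x*a ⟨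
    + (1 ℕ.+ y ℕ.* n) - 1ℤ   ≡⟨ cong (λ t → 1ℤ + t - 1ℤ) (pos-* y n) ⟩
    1ℤ + + y * + n - 1ℤ      ≡⟨ 1+t-1≡t (+ y * + n) ⟩
    + y * + n                ∎)
    where
    open ≡-Reasoning
    1+t-1≡t : ∀ t → 1ℤ + t - 1ℤ ≡ t
    1+t-1≡t = solve-∀
  bézout⇒inverse {a} {n} (Bézout.-+ x y 1+x*a≡y*n) = - + x , divides (- + y) (begin
    + a * - + x - 1ℤ         ≡⟨ rearrange (+ a) (+ x) ⟩
    - (1ℤ + + x * + a)       ≡⟨ cong (λ t → - (1ℤ + t)) (pos-* x a) ⟨
    - + (1 ℕ.+ x ℕ.* a)      ≡⟨ cong (λ t → - + t) 1+x*a≡y*n ⟩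
    - + (y ℕ.* n)            ≡⟨ cong -_ (pos-* y n) ⟩
    - (+ y * + n)            ≡⟨ neg-distribˡ-* (+ y) (+ n) ⟩
    - + y * + n              ∎)
    where
    open ≡-Reasoning
    rearrange : ∀ a x → a * - x - 1ℤ ≡ - (1ℤ + x * a)
    rearrange = solve-∀

  inverse-mod : ∀ a n → gcd ∣ a ∣ n ≡ 1 → ∃[ b ] + n ∣ a * b - 1ℤ
  inverse-mod (+ a) n gcd≡1 = bézout⇒inverse (coprime-Bézout (gcd≡1⇒coprime {a} gcd≡1))
  inverse-mod -[1+ a ] n gcd≡1 with b , n∣ab-1 ← inverse-mod (+ ℕ.suc a) n gcd≡1 =
    - b , subst (+ n ∣_) (negate-both (+ ℕ.suc a) b) n∣ab-1
    where
    negate-both : ∀ a b → a * b - 1ℤ ≡ - a * - b - 1ℤ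
    negate-both = solve-∀

  module _ {ψ : ℤ → Sign} {d : ℕ} (period : Periodic ψ d) where

    periodic-ℕ-multiple : ∀ x k → ψ (x + + k * + d) ≡ ψ x
    periodic-ℕ-multiple x ℕ.zero = cong ψ (+-identityʳ x)
    periodic-ℕ-multiple x (ℕ.suc k) = begin
      ψ (x + + ℕ.suc k * + d)  ≡⟨ cong ψ (peel x (+ k) (+ d)) ⟩
      ψ (x + + k * + d + + d)  ≡⟨ period _ ⟩
      ψ (x + + k * + d)        ≡⟨ periodic-ℕ-multiple x k ⟩
      ψ x                      ∎
      where
      open ≡-Reasoning
      peel : ∀ x k d → x + (1ℤ + k) * d ≡ x + k * d + d
      peel = solve-∀

    periodic-multiple : ∀ x k → ψ (x + k * + d) ≡ ψ x
    periodic-multiple x (+ k) = periodic-ℕ-multiple x k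
    periodic-multiple x k@(-[1+ n ]) = begin
      ψ (x + k * + d)                     ≡⟨ periodic-ℕ-multiple _ (ℕ.suc n) ⟨
      ψ (x + k * + d + + ℕ.suc n * + d)   ≡⟨ cong ψ (cancel x (+ ℕ.suc n) (+ d)) ⟩
      ψ x                                 ∎
      where
      open ≡-Reasoning
      cancel : ∀ x s d → x + - s * d + s * d ≡ x
      cancel = solve-∀

    periodic⇒≡-mod : ∀ {a b} → + d ∣ a - b → ψ a ≡ ψ b
    periodic⇒≡-mod {a} {b} (divides k a-b≡k*d) =
      trans (cong ψ (trans (a≡b+[a-b] a b) (cong (λ t → b + t) a-b≡k*d))) (periodic-multiple b k)
      where
      a≡b+[a-b] : ∀ a b → a ≡ b + (a - b)
      a≡b+[a-b] = solve-∀

module PrimeSquareDivisor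
  {q : ℕ} {ψ : ℤ → Sign} (q-period : Periodic ψ q) (funEq : FunEq q ψ) .{{_ : ℕ.NonZero q}}
  {p m : ℕ} (p-prime : Prime p) (p-odd : ¬ 2 ℕ.∣ p)
  (q≡m*p : q ≡ m ℕ.* p) (p∣m : p ℕ.∣ m)
  where
  open import Data.Integer
  open import Data.Integer.Properties using (pos-*; *-zeroʳ)
  open import Data.Integer.Divisibility.Signed
  open import Data.Integer.DivMod using (_/ℕ_; _%ℕ_; a≡a%ℕn+[a/ℕn]*n)
  open import Data.Integer.Tactic.RingSolver using (solve-∀)
  open import Data.Nat.GCD using (gcd)
  import Data.Nat.Properties as ℕ
  open import Data.Nat.Primality using (euclidsLemma; prime⇒nonZero; prime[2])
  open import Data.Sign using () renaming (_*_ to _·_)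
  open import Data.Sign.Properties using (s*s≡+; *-cancelʳ-≡)
  open import Data.Product using (∃-syntax; _×_)
  open import Data.Sum using (inj₁; inj₂)
  open import Function using (_∘_)
  open import Relation.Binary.PropositionalEquality
  open Primes
    using (prime>1; prime∣prime⇒≡; prime∣^⇒≡; no-common-prime⇒gcd≡1; ¬prime∣⇒gcd≡1; prime-power-split)
  open Parity using (odd-return⇒constant)
  open Residues

  denominator numerator : ℤ → ℤ → ℤ → ℤ
  denominator x y z = + 4 * (x * y + y * z + z * x) - 1ℤ
  numerator x y z = + 4 * x * y * z - x - y - z

  Q M P : ℤ
  Q = + q
  M = + m
  P = + p

  Q≡M*P : Q ≡ M * P
  Q≡M*P = trans (cong +_ q≡m*p) (pos-* m p)

  P∣M : P ∣ M
  P∣M = ∣ᵤ⇒∣ p∣m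

  Q∣M*_ : ∀ {X} → P ∣ X → Q ∣ M * X
  Q∣M*_ {X} (divides s X≡s*P) = divides s (begin
    M * X        ≡⟨ cong (M *_) X≡s*P ⟩
    M * (s * P)  ≡⟨ reorder M s P ⟩
    s * (M * P)  ≡⟨ cong (s *_) Q≡M*P ⟨
    s * Q        ∎)
    where
    open ≡-Reasoning
    reorder : ∀ m s p → m * (s * p) ≡ s * (m * p)
    reorder = solve-∀

  Q∣M*M* : ∀ X → Q ∣ M * (M * X)
  Q∣M*M* X = Q∣M* ∣m⇒∣m*n X P∣M

  ψ-mod : ∀ {a b} → Q ∣ a - b → ψ a ≡ ψ b
  ψ-mod = periodic⇒≡-mod q-period

  UnitMod : ℤ → Set
  UnitMod D = ∀ r → Prime r → r ℕ.∣ q → ¬ (+ r ∣ D)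

  unitMod-[-1] : UnitMod -1ℤ
  unitMod-[-1] r r-prime _ r∣-1 = ℕ.<⇒≢ (prime>1 r-prime) (sym (ℕ.∣1⇒≡1 (∣⇒∣ᵤ r∣-1)))

  prime∣q⇒∣m : ∀ {r} → Prime r → r ℕ.∣ q → r ℕ.∣ m
  prime∣q⇒∣m {r} r-prime r∣q with euclidsLemma m p r-prime (subst (r ℕ.∣_) q≡m*p r∣q)
  ... | inj₁ r∣m = r∣m
  ... | inj₂ r∣p = subst (ℕ._∣ m) (sym (prime∣prime⇒≡ r-prime p-prime r∣p)) p∣m

  unitMod-+M* : ∀ {D} X → UnitMod D → UnitMod (D + M * X)
  unitMod-+M* X unit r r-prime r∣q r∣D+MX =
    unit r r-prime r∣q (∣m+n∣n⇒∣m r∣D+MX (∣m⇒∣m*n {m = M} X (∣ᵤ⇒∣ (prime∣q⇒∣m r-prime r∣q))))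

  unitMod⇒gcd≡1 : ∀ {D} → UnitMod D → gcd ∣ D ∣ q ≡ 1
  unitMod⇒gcd≡1 unit =
    no-common-prime⇒gcd≡1 _ q λ r r-prime r∣D r∣q → unit r r-prime r∣q (∣ᵤ⇒∣ r∣D)

  funEq-unit : ∀ x y z w → UnitMod (denominator x y z) →
           Q ∣ denominator x y z * w - numerator x y z → ψ x · ψ y · ψ z ≡ ψ w
  funEq-unit x y z w unit Q∣Dw-N = funEq x y z (cong +_ (unitMod⇒gcd≡1 unit)) w (∣⇒∣ᵤ Q∣Dw-N)

  K : ℤ → ℤ
  K z = 1ℤ + + 4 * z * z

  funEq-0-Mc : ∀ c z → ψ 0ℤ · ψ (M * c) · ψ z ≡ ψ (z + M * c * K z)
  funEq-0-Mc c z =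
    funEq-unit 0ℤ (M * c) z (z + M * c * K z) unit (subst (Q ∣_) (sym (Dw-N≡ M c z)) (Q∣M*M* _))
    where
    D≡ : ∀ M c z → + 4 * (0ℤ * (M * c) + M * c * z + z * 0ℤ) - 1ℤ ≡ -1ℤ + M * (+ 4 * c * z)
    D≡ = solve-∀
    unit : UnitMod (denominator 0ℤ (M * c) z)
    unit = subst UnitMod (sym (D≡ M c z)) (unitMod-+M* (+ 4 * c * z) unitMod-[-1])
    Dw-N≡ : ∀ M c z → (+ 4 * (0ℤ * (M * c) + M * c * z + z * 0ℤ) - 1ℤ) * (z + M * c * (1ℤ + + 4 * z * z))
                      - (+ 4 * 0ℤ * (M * c) * z - 0ℤ - M * c - z)
                      ≡ M * (M * (+ 4 * c * c * z * (1ℤ + + 4 * z * z)))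
    Dw-N≡ = solve-∀

  ψ-constant-on-Mℤ : ∀ c → ψ (M * c) ≡ ψ 0ℤ
  ψ-constant-on-Mℤ c = begin
    ψ (M * c)                ≡⟨ ψ-mod (divides (c /ℕ p) reduce) ⟩
    ψ (M * + (c %ℕ p))       ≡⟨ odd-return⇒constant f (ψ 0ℤ · f 1) f-step p-odd fp≡f0 (c %ℕ p) ⟩
    f 0                      ≡⟨ cong ψ (*-zeroʳ M) ⟩
    ψ 0ℤ                     ∎
    where
    open ≡-Reasoning
    instance _ = prime⇒nonZero p-prime
    f : ℕ → Sign
    f n = ψ (M * + n)
    f-step : ∀ n → f (ℕ.suc n) ≡ ψ 0ℤ · f 1 · f n
    f-step n = trans (ψ-mod (subst (Q ∣_) (sym (step-difference M (+ n))) (Q∣M*M* _)))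
                     (sym (funEq-0-Mc 1ℤ (M * + n)))
      where
      step-difference : ∀ M n → M * (1ℤ + n) - (M * n + M * 1ℤ * (1ℤ + + 4 * (M * n) * (M * n)))
                                ≡ M * (M * - (+ 4 * M * n * n))
      step-difference = solve-∀
    fp≡f0 : f p ≡ f 0
    fp≡f0 = ψ-mod (divides 1ℤ (trans (MP-M0≡MP M P) (cong (1ℤ *_) (sym Q≡M*P))))
      where
      MP-M0≡MP : ∀ M P → M * P - M * 0ℤ ≡ 1ℤ * (M * P)
      MP-M0≡MP = solve-∀
    reduce : M * c - M * + (c %ℕ p) ≡ c /ℕ p * Q
    reduce = begin
      M * c - M * + (c %ℕ p)                          ≡⟨ cong (λ t → M * t - M * + (c %ℕ p)) (a≡a%ℕn+[a/ℕn]*n c p) ⟩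
      M * (+ (c %ℕ p) + c /ℕ p * P) - M * + (c %ℕ p)  ≡⟨ cancel M (+ (c %ℕ p)) (c /ℕ p) P ⟩
      c /ℕ p * (M * P)                                ≡⟨ cong (c /ℕ p *_) Q≡M*P ⟨
      c /ℕ p * Q                                      ∎
      where
      cancel : ∀ M r k P → M * (r + k * P) - M * r ≡ k * (M * P)
      cancel = solve-∀

  ψ-invariant-M*K : ∀ c z → ψ (z + M * c * K z) ≡ ψ z
  ψ-invariant-M*K c z = begin
    ψ (z + M * c * K z)        ≡⟨ funEq-0-Mc c z ⟨
    ψ 0ℤ · ψ (M * c) · ψ z     ≡⟨ cong (λ s → ψ 0ℤ · s · ψ z) (ψ-constant-on-Mℤ c) ⟩
    ψ 0ℤ · ψ 0ℤ · ψ z          ≡⟨ cong (_· ψ z) (s*s≡+ (ψ 0ℤ)) ⟩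
    ψ z                        ∎
    where open ≡-Reasoning

  shift-M-when-P∤K : ∀ z → ¬ P ∣ K z → ψ (z + M) ≡ ψ z
  shift-M-when-P∤K z P∤Kz
    with c , P∣Kc-1 ← inverse-mod (K z) p (¬prime∣⇒gcd≡1 p-prime (P∤Kz ∘ ∣ᵤ⇒∣)) =
    trans (ψ-mod (subst (Q ∣_) (sym (difference z M c (K z))) (Q∣M* ∣m⇒∣-m P∣Kc-1)))
          (ψ-invariant-M*K c z)
    where
    difference : ∀ z M c k → z + M - (z + M * c * k) ≡ M * - (k * c - 1ℤ)
    difference = solve-∀

  partner-unitMod : ∀ a {n} z e → q ≡ p ℕ.^ a ℕ.* n → P ∣ + n * e - 1ℤ → P ∣ K z →
                    UnitMod (denominator z 0ℤ (z * + n * e))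
  partner-unitMod a {n} z e q≡p^a*n P∣ne-1 P∣Kz r r-prime r∣q r∣D
    with euclidsLemma (p ℕ.^ a) n r-prime (subst (r ℕ.∣_) q≡p^a*n r∣q)
  ... | inj₂ r∣n = unitMod-[-1] r r-prime r∣q
    (subst (+ r ∣_) (sym (-1≡D-z′*4z z (z * + n * e)))
      (∣m∣n⇒∣m+n r∣D (∣m⇒∣-m (∣m⇒∣m*n (+ 4 * z) (∣m⇒∣m*n e (∣n⇒∣m*n z (∣ᵤ⇒∣ r∣n)))))))
    where
    -1≡D-z′*4z : ∀ z z′ → -1ℤ ≡ + 4 * (z * 0ℤ + 0ℤ * z′ + z′ * z) - 1ℤ + - (z′ * (+ 4 * z))
    -1≡D-z′*4z = solve-∀
  ... | inj₁ r∣p^a with refl ← prime∣^⇒≡ a r-prime p-prime r∣p^a =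
    p-odd (subst (2 ℕ.∣_) (sym (prime∣prime⇒≡ p-prime prime[2] (∣⇒∣ᵤ P∣2))) (ℕ.∣-refl {2}))
    where
    2≡K+4zz[ne-1]-D : ∀ z N e → + 2 ≡ 1ℤ + + 4 * z * z + + 4 * z * z * (N * e - 1ℤ)
                                     - (+ 4 * (z * 0ℤ + 0ℤ * (z * N * e) + z * N * e * z) - 1ℤ)
    2≡K+4zz[ne-1]-D = solve-∀
    P∣2 : P ∣ + 2
    P∣2 = subst (P ∣_) (sym (2≡K+4zz[ne-1]-D z (+ n) e))
            (∣m∣n⇒∣m-n (∣m∣n⇒∣m+n P∣Kz (∣n⇒∣m*n (+ 4 * z * z) P∣ne-1)) r∣D)

  partner : ∀ z → P ∣ K z → ∃[ z′ ] UnitMod (denominator z 0ℤ z′) × P ∣ K z′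
  partner z P∣Kz
    with a , n , q≡p^a*n , p∤n ← prime-power-split (prime>1 p-prime) q
    with e , P∣ne-1 ← inverse-mod (+ n) p (¬prime∣⇒gcd≡1 p-prime p∤n) =
    z * + n * e , partner-unitMod a z e q≡p^a*n P∣ne-1 P∣Kz ,
    subst (P ∣_) (sym (K-shift z (+ n) e))
      (∣m∣n⇒∣m+n P∣Kz (∣m⇒∣m*n (+ 4 * z * (z * + n * e + z)) P∣ne-1))
    where
    K-shift : ∀ z N e → 1ℤ + + 4 * (z * N * e) * (z * N * e)
                      ≡ 1ℤ + + 4 * z * z + (N * e - 1ℤ) * (+ 4 * z * (z * N * e + z))
    K-shift = solve-∀

  shift-M-via-inverse : ∀ z z′ b → UnitMod (denominator z 0ℤ z′) → P ∣ K z′ →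
                        Q ∣ denominator z 0ℤ z′ * b - 1ℤ → ψ (z + M) ≡ ψ z
  shift-M-via-inverse z z′ b unit P∣Kz′ Q∣Db-1 =
    *-cancelʳ-≡ _ _ _ (*-cancelʳ-≡ _ _ _
      (trans (funEq-unit (z + M) 0ℤ z′ w unit′ Q∣D′w-N′) (sym (funEq-unit z 0ℤ z′ w unit Q∣Dw-N))))
    where
    D = denominator z 0ℤ z′
    w = - ((z + z′) * b)
    D′≡D+M*4z′ : ∀ z M z′ → + 4 * ((z + M) * 0ℤ + 0ℤ * z′ + z′ * (z + M)) - 1ℤ
                          ≡ + 4 * (z * 0ℤ + 0ℤ * z′ + z′ * z) - 1ℤ + M * (+ 4 * z′)
    D′≡D+M*4z′ = solve-∀
    unit′ : UnitMod (denominator (z + M) 0ℤ z′)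
    unit′ = subst UnitMod (sym (D′≡D+M*4z′ z M z′)) (unitMod-+M* (+ 4 * z′) unit)
    Dw-N≡ : ∀ z z′ b → (+ 4 * (z * 0ℤ + 0ℤ * z′ + z′ * z) - 1ℤ) * - ((z + z′) * b)
                       - (+ 4 * z * 0ℤ * z′ - z - 0ℤ - z′)
                       ≡ - (z + z′) * ((+ 4 * (z * 0ℤ + 0ℤ * z′ + z′ * z) - 1ℤ) * b - 1ℤ)
    Dw-N≡ = solve-∀
    Q∣Dw-N : Q ∣ D * w - numerator z 0ℤ z′
    Q∣Dw-N = subst (Q ∣_) (sym (Dw-N≡ z z′ b)) (∣n⇒∣m*n (- (z + z′)) Q∣Db-1)
    D′w-N′≡ : ∀ z M z′ b → (+ 4 * ((z + M) * 0ℤ + 0ℤ * z′ + z′ * (z + M)) - 1ℤ) * - ((z + z′) * b)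
                           - (+ 4 * (z + M) * 0ℤ * z′ - (z + M) - 0ℤ - z′)
                           ≡ - (z + z′) * ((+ 4 * (z * 0ℤ + 0ℤ * z′ + z′ * z) - 1ℤ) * b - 1ℤ)
                             + M * (- (b * (1ℤ + + 4 * z′ * z′))
                                    - ((+ 4 * (z * 0ℤ + 0ℤ * z′ + z′ * z) - 1ℤ) * b - 1ℤ))
    D′w-N′≡ = solve-∀
    Q∣D′w-N′ : Q ∣ denominator (z + M) 0ℤ z′ * w - numerator (z + M) 0ℤ z′
    Q∣D′w-N′ = subst (Q ∣_) (sym (D′w-N′≡ z M z′ b))
      (∣m∣n⇒∣m+n (∣n⇒∣m*n (- (z + z′)) Q∣Db-1)
                 (Q∣M* ∣m∣n⇒∣m-n (∣m⇒∣-m (∣n⇒∣m*n b P∣Kz′)) (∣-trans (divides M Q≡M*P) Q∣Db-1)))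

  shift-M-when-P∣K : ∀ z → P ∣ K z → ψ (z + M) ≡ ψ z
  shift-M-when-P∣K z P∣Kz =
    let z′ , unit , P∣Kz′ = partner z P∣Kz
        b , Q∣Db-1 = inverse-mod (denominator z 0ℤ z′) q (unitMod⇒gcd≡1 unit)
    in shift-M-via-inverse z z′ b unit P∣Kz′ Q∣Db-1

  periodic-m : Periodic ψ m
  periodic-m z with P ∣? K z
  ... | yes P∣Kz = shift-M-when-P∣K z P∣Kz
  ... | no P∤Kz  = shift-M-when-P∤K z P∤Kz

open TwoAdic using (odd-prime-square-divisor)
open Primes using (prime>1; square-divisor-cofactor)
open PrimeSquareDivisor using (periodic-m)

lemma7p8 : (q : ℕ) → 1 ≤ q → (ψ : ℤ → Sign) →
    Primitive q ψ → FunEq q ψ → Squarefree (oddPart q)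
lemma7p8 q@(ℕ.suc _) _ ψ (q-period , minimal) funEq d d²∣oddPart with d ℕ.≟ 1
... | yes d≡1 = d≡1
... | no d≢1
  with p , p-prime , p-odd , p²∣q ← odd-prime-square-divisor d²∣oddPart d≢1
  with m , 0<m , m<q , q≡m*p , p∣m ← square-divisor-cofactor (prime>1 p-prime) p²∣q =
  ⊥-elim (minimal m 0<m m<q (periodic-m q-period funEq p-prime p-odd q≡m*p p∣m))
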